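{- Let $n\ge 2$ and let $\mathcal{F}$ be a maximal coclique of $\Gamma_{2n}$. Let $A$ be an $(n-1)$-space of $\mathrm{PG}(2n,q)$ that occurs in some flag of $\mathcal{F}$. Then there exists $k\in\{1,\ldots,n+1\}$ such that the number of flags in $\mathcal{F}$ whose $(n-1)$-space is $A$ is exactly $\begin{bmatrix}k\\ 1\end{bmatrix}_q$. Moreover, this number equals $\begin{bmatrix}n+1\\ 1\end{bmatrix}_q$ if and only if every flag $(A',B')\in\mathcal{F}$ satisfies $B'\cap A\neq\emptyset$.
   Context: $\mathrm{PG}(2n,q)$ is the projective space of projective dimension $2n$ over $\mathbb{F}_q$; an $i$-space is a subspace of projective dimension $i$. An $(n-1,n)$-flag is a pair $(A,B)$ with $A$ an $(n-1)$-space, $B$ an $n$-space and $A\subseteq B$. Two flags $(A_1,B_1),(A_2,B_2)$ are opposite if $A_1\cap B_2=A_2\cap B_1=\emptyset$. $\Gamma_{2n}$ is the graph on $(n-1,n)$-flags with adjacency being oppositeness. A maximal coclique is a set of pairwise non-opposite flags not properly contained in another such set. $\begin{bmatrix}k\\ 1\end{bmatrix}_q=\frac{q^k-1}{q-1}$. -}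

module Defs where

open import Level using (0ℓ)
open import Data.Nat using (ℕ; zero; suc; _+_; _^_; _∸_)
open import Data.Bool using (Bool; true)
open import Data.Fin using (Fin) renaming (zero to fzero; suc to fsuc)
open import Data.Vec using (Vec; replicate; zipWith; map)
open import Data.List using (List; length)
open import Data.List.Membership.Propositional using (_∈_)
open import Data.List.Relation.Unary.Any using (Any)
open import Data.List.Relation.Unary.AllPairs using (AllPairs)
open import Data.List.Relation.Unary.Unique.Propositional using (Unique)
open import Data.Product using (Σ; _×_; ∃-syntax)
open import Relation.Binary.PropositionalEquality using (_≡_; _≢_)
open import Relation.Binary.Definitions using (DecidableEquality)
open import Relation.Nullary using (¬_)
open import Algebra.Structures using (IsCommutativeRing)

record FiniteField : Set₁ where
  infixl 6 _+ᶠ_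
  infixl 7 _*ᶠ_
  field
    K        : Set
    _+ᶠ_     : K → K → K
    _*ᶠ_     : K → K → K
    -ᶠ_      : K → K
    0ᶠ       : K
    1ᶠ       : K
    isCommutativeRing : IsCommutativeRing _≡_ _+ᶠ_ _*ᶠ_ -ᶠ_ 0ᶠ 1ᶠ
    0≢1      : 0ᶠ ≢ 1ᶠ
    inverse  : ∀ x → x ≢ 0ᶠ → Σ K (λ y → x *ᶠ y ≡ 1ᶠ)
    _≟ᶠ_     : DecidableEquality K
    elements : List K
    complete : ∀ x → x ∈ elements
    distinct : Unique elements

  q : ℕ
  q = length elements

-- Gaussian coefficient [k 1]_q = (q^k - 1)/(q - 1) = 1 + q + ... + q^(k-1)

gauss1 : ℕ → ℕ → ℕ
gauss1 q zero    = 0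
gauss1 q (suc k) = q ^ k + gauss1 q k

module Geometry (𝔽 : FiniteField) (m : ℕ) where
  open FiniteField 𝔽

  V : Set
  V = Vec K m

  0v : V
  0v = replicate m 0ᶠ

  _+v_ : V → V → V
  _+v_ = zipWith _+ᶠ_

  _·v_ : K → V → V
  c ·v v = map (c *ᶠ_) v

  lincomb : ∀ {d} → (Fin d → K) → (Fin d → V) → V
  lincomb {zero}  c b = 0v
  lincomb {suc d} c b = (c fzero ·v b fzero) +v lincomb (λ i → c (fsuc i)) (λ i → b (fsuc i))

  record Subspace : Set where
    field
      mem      : V → Bool
      has-0    : mem 0v ≡ true
      closed-+ : ∀ u v → mem u ≡ true → mem v ≡ true → mem (u +v v) ≡ true
      closed-· : ∀ c v → mem v ≡ true → mem (c ·v v) ≡ true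
  open Subspace public

  _∋_ : Subspace → V → Set
  S ∋ v = mem S v ≡ true

  HasDim : Subspace → ℕ → Set
  HasDim S d = Σ (Fin d → V) λ b →
      (∀ i → S ∋ b i)
    × (∀ c → lincomb c b ≡ 0v → ∀ i → c i ≡ 0ᶠ)
    × (∀ v → S ∋ v → ∃[ c ] (v ≡ lincomb c b))

  -- projective i-space = vector subspace of dimension i+1
  IsSpace : ℕ → Subspace → Set
  IsSpace i S = HasDim S (suc i)

  _⊆_ : Subspace → Subspace → Set
  S ⊆ T = ∀ v → S ∋ v → T ∋ v

  _≐_ : Subspace → Subspace → Set
  S ≐ T = ∀ v → mem S v ≡ mem T v

  -- projectively empty intersection: only the zero vector is common
  Disjoint : Subspace → Subspace → Set
  Disjoint S T = ∀ v → S ∋ v → T ∋ v → v ≡ 0v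

-- PG(2n,q) = projective geometry of K^(2n+1); (n-1,n)-flags, the graph
-- Γ_{2n}, cocliques and maximal cocliques (finite sets of flags = lists,
-- membership taken up to equality of flags).

module FlagGraph (𝔽 : FiniteField) (n : ℕ) where
  open Geometry 𝔽 (suc (n + n)) public

  record Flag : Set where
    constructor flag
    field
      A    : Subspace
      B    : Subspace
      A-sp : IsSpace (n ∸ 1) A
      B-sp : IsSpace n B
      A⊆B  : A ⊆ B
  open Flag public

  _≐F_ : Flag → Flag → Set
  f ≐F g = (A f ≐ A g) × (B f ≐ B g)

  Opposite : Flag → Flag → Set
  Opposite f g = Disjoint (A f) (B g) × Disjoint (A g) (B f)

  _∈F_ : Flag → List Flag → Set
  f ∈F 𝓕 = Any (f ≐F_) 𝓕

  IsCoclique : List Flag → Set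
  IsCoclique 𝓕 = ∀ f g → f ∈F 𝓕 → g ∈F 𝓕 → ¬ Opposite f g

  IsMaximalCoclique : List Flag → Set
  IsMaximalCoclique 𝓕 = IsCoclique 𝓕 ×
    (∀ 𝓖 → IsCoclique 𝓖 → (∀ f → f ∈F 𝓕 → f ∈F 𝓖) → ∀ g → g ∈F 𝓖 → g ∈F 𝓕)

  NumFlagsWith : List Flag → Subspace → ℕ → Set
  NumFlagsWith 𝓕 S N = Σ (List Flag) λ L →
      (∀ f → (f ∈F 𝓕 × A f ≐ S) → f ∈F L)
    × (∀ f → f ∈F L → f ∈F 𝓕 × A f ≐ S)
    × AllPairs (λ f g → ¬ (f ≐F g)) L
    × length L ≡ N

{-# OPTIONS --safe #-}
-- Let W be the intersection of the spaces ⟨A′, S⟩ over the flags (A′, B′) ∈ 𝓕 with B′ ∩ S = ∅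
-- (the whole space if there is none), and write dim W = n + k with S ⊆ W.
-- If (S, B) ∈ 𝓕 and B′ ∩ S = ∅, then (S, B) is not opposite to (A′, B′), so some nonzero y lies
-- in A′ ∩ B; y ∉ S, hence B = ⟨y, S⟩ ⊆ ⟨A′, S⟩.  So every flag of 𝓕 through S has B ⊆ W.
-- Conversely, if S ⊂ B ⊆ W with dim B = n + 1, then (S, B) is opposite to no flag of 𝓕: otherwise
-- B′ ∩ S = ∅ and A′ ∩ B = ∅, and a vector of B outside S, lying in A′ ⊕ S, would lie in S.
-- By maximality (S, B) ∈ 𝓕.  The flags of 𝓕 through S therefore correspond to the points of
-- W/S ≅ PG(k - 1, q), and there are [k 1]_q of them.  Some flag through S exists, so k ≥ 1;
-- dim W ≤ 2n + 1 gives k ≤ n + 1, with equality iff W is everything, i.e. iff no B′ misses S,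
-- since each ⟨A′, S⟩ has dimension at most 2n.
-- Dimensions are compared by counting: d independent vectors span exactly q^d vectors.
module Submission where

open import Defs
open import Algebra.Structures using (IsCommutativeRing)
open import Data.Bool as Bool using (true; false)
open import Data.Bool.Properties using (T-≡)
open import Data.Empty using (⊥)
open import Data.Fin using (zero; suc; splitAt)
open import Data.List as List using (List; []; _∷_; length; map; cartesianProductWith)
open import Data.List.Properties using (length-removeAt′; length-++; length-map)
open import Data.List.Membership.Propositional using (_∈_; mapWith∈; lose; find)
open import Data.List.Membership.Propositional.Properties
  using (∈-cartesianProductWith⁺; ∈-map⁺; ∈-map⁻; ∈-++⁺ˡ; ∈-++⁺ʳ; ∈-++⁻)
open import Data.List.Relation.Unary.All as All using (All; []; _∷_; all?)
open import Data.List.Relation.Unary.AllPairs using (AllPairs; []; _∷_)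
open import Data.List.Relation.Unary.Any as Any using (here; there; index; _─_; any?)
open import Data.List.Relation.Unary.Any.Properties using (mapWith∈⁺; mapWith∈⁻)
open import Data.List.Relation.Unary.Unique.Propositional using (Unique)
import Data.List.Relation.Unary.Unique.Propositional.Properties as Unique
open import Data.Nat using (ℕ; zero; suc; _≤_; _<_; _∸_; _+_; _*_; _^_; z≤n; s≤s; s≤s⁻¹; NonZero; >-nonZero)
open import Data.Nat.Properties
  using ( ≤-antisym; ≤-trans; <-trans; ≮⇒≥; <⇒≢; <⇒≱; 1+n≰n; m≤n⇒m<n∨m≡n
        ; m<n+m; m≤m+n; +-suc; +-cancelʳ-≤; m^n>0; ^-monoʳ-<)
open import Data.Product using (Σ; _×_; _,_; proj₁; proj₂; ∃; ∃-syntax)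
open import Data.Sum using (_⊎_; inj₁; inj₂)
open import Data.Sum.Properties using ([,]-map)
open import Data.Vec as Vec using (Vec; []; _∷_; replicate; zipWith)
open import Data.Vec.Properties
  using ( zipWith-assoc; zipWith-comm; zipWith-identityˡ; zipWith-identityʳ; lookup∘tabulate
        ; ++-injectiveˡ; ∷-injective; ∷-injectiveˡ; ∷-injectiveʳ; ≡-dec)
open import Data.Vec.Functional using (Vector; tail; _++_) renaming (_∷_ to _∷ᵛ_)
open import Data.Vec.Functional.Relation.Unary.All.Properties using (++⁺)
open import Function using (_∘_)
open import Function.Bundles using (_⇔_; mk⇔; Equivalence)
open import Relation.Binary.Definitions using (DecidableEquality)
open import Relation.Binary.PropositionalEquality
  using (_≡_; _≢_; refl; sym; trans; cong; cong₂; subst; subst₂; _≗_; module ≡-Reasoning)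
open import Relation.Nullary using (¬_; Dec; yes; no; contradiction)
open import Relation.Nullary.Decidable
  using (decidable-stable; ⌊_⌋; toWitness; fromWitness; _×-dec_; _→-dec_; ¬?)
open import Relation.Unary using (Decidable)

module _ {A : Set} where

  ⌊⌋≡true⁺ : (a? : Dec A) → A → ⌊ a? ⌋ ≡ true
  ⌊⌋≡true⁺ a? = Equivalence.to T-≡ ∘ fromWitness

  ⌊⌋≡true⁻ : (a? : Dec A) → ⌊ a? ⌋ ≡ true → A
  ⌊⌋≡true⁻ a? = toWitness ∘ Equivalence.from T-≡

  ∈-─ : ∀ {x z} {ys : List A} (x∈ys : x ∈ ys) → z ∈ ys → z ≢ x → z ∈ (ys ─ x∈ys)
  ∈-─ (here refl)  (here refl)  z≢x = contradiction refl z≢x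
  ∈-─ (here refl)  (there z∈ys) _   = z∈ys
  ∈-─ (there _)    (here refl)  _   = here refl
  ∈-─ (there x∈ys) (there z∈ys) z≢x = there (∈-─ x∈ys z∈ys z≢x)

  Unique-⊆⇒length≤ : ∀ {xs ys : List A} → Unique xs → (∀ {z} → z ∈ xs → z ∈ ys) →
                     length xs ≤ length ys
  Unique-⊆⇒length≤ {[]}     _              _   = z≤n
  Unique-⊆⇒length≤ {x ∷ xs} {ys} (x∉xs ∷ xs!) xs⊆ys = begin
    suc (length xs)           ≤⟨ s≤s (Unique-⊆⇒length≤ xs! xs⊆ys─x) ⟩
    suc (length (ys ─ x∈ys))  ≡⟨ length-removeAt′ ys (index x∈ys) ⟨
    length ys                 ∎
    where
    open Data.Nat.Properties.≤-Reasoning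
    x∈ys : x ∈ ys
    x∈ys = xs⊆ys (here refl)
    xs⊆ys─x : ∀ {z} → z ∈ xs → z ∈ (ys ─ x∈ys)
    xs⊆ys─x z∈xs = ∈-─ x∈ys (xs⊆ys (there z∈xs)) (λ { refl → All.lookup x∉xs z∈xs refl })

  module _ {B : Set} where

    length-cartesianProductWith : ∀ {C : Set} (f : A → B → C) xs ys →
      length (cartesianProductWith f xs ys) ≡ length xs * length ys
    length-cartesianProductWith f []       ys = refl
    length-cartesianProductWith f (x ∷ xs) ys = begin
      length (map (f x) ys List.++ cartesianProductWith f xs ys)      ≡⟨ length-++ (map (f x) ys) ⟩
      length (map (f x) ys) + length (cartesianProductWith f xs ys)
        ≡⟨ cong₂ _+_ (length-map (f x) ys) (length-cartesianProductWith f xs ys) ⟩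
      length ys + length xs * length ys                           ∎
      where open ≡-Reasoning

    length-mapWith∈ : ∀ (xs : List A) (f : ∀ {x} → x ∈ xs → B) → length (mapWith∈ xs f) ≡ length xs
    length-mapWith∈ []       f = refl
    length-mapWith∈ (x ∷ xs) f = cong suc (length-mapWith∈ xs (f ∘ there))

    mapWith∈-AllPairs : ∀ (R : B → B → Set) {xs : List A} (f : ∀ {x} → x ∈ xs → B) → Unique xs →
      (∀ {x y} (x∈xs : x ∈ xs) (y∈xs : y ∈ xs) → R (f x∈xs) (f y∈xs) → x ≡ y) →
      AllPairs (λ a b → ¬ R a b) (mapWith∈ xs f)
    mapWith∈-AllPairs R {[]}     f []           f-inj = []
    mapWith∈-AllPairs R {x ∷ xs} f (x∉xs ∷ xs!) f-inj =
      All.tabulate head-unrelated ∷ mapWith∈-AllPairs R (f ∘ there) xs! (λ p q → f-inj (there p) (there q))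
      where
      head-unrelated : ∀ {b} → b ∈ mapWith∈ xs (f ∘ there) → ¬ R (f (here refl)) b
      head-unrelated b∈ r with mapWith∈⁻ xs (f ∘ there) b∈
      ... | y , y∈xs , refl = All.lookup x∉xs y∈xs (f-inj (here refl) (there y∈xs) r)

module _ (q : ℕ) .{{_ : NonZero q}} where

  gauss1-<-suc : ∀ k → gauss1 q k < gauss1 q (suc k)
  gauss1-<-suc k = m<n+m (gauss1 q k) (m^n>0 q k)

  gauss1-monoʳ-< : ∀ {a b} → a < b → gauss1 q a < gauss1 q b
  gauss1-monoʳ-< {a} {suc b} a<1+b with m≤n⇒m<n∨m≡n (s≤s⁻¹ a<1+b)
  ... | inj₁ a<b  = <-trans (gauss1-monoʳ-< a<b) (gauss1-<-suc b)
  ... | inj₂ refl = gauss1-<-suc b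

  gauss1-injective : ∀ {a b} → gauss1 q a ≡ gauss1 q b → a ≡ b
  gauss1-injective eq = ≤-antisym
    (≮⇒≥ (λ b<a → <⇒≢ (gauss1-monoʳ-< b<a) (sym eq)))
    (≮⇒≥ (λ a<b → <⇒≢ (gauss1-monoʳ-< a<b) eq))

module VectorAlgebra (𝔽 : FiniteField) where
  open FiniteField 𝔽 public
  open IsCommutativeRing isCommutativeRing public
    using (+-assoc; +-comm; +-identityˡ; +-identityʳ; -‿inverseʳ;
           *-assoc; *-comm; *-identityˡ; *-identityʳ; distribˡ; distribʳ; zeroˡ; zeroʳ)

  -1ᶠ : K
  -1ᶠ = -ᶠ 1ᶠ

  inverseˡ : ∀ {x} → x ≢ 0ᶠ → ∃ λ y → y *ᶠ x ≡ 1ᶠ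
  inverseˡ {x} x≢0 with inverse x x≢0
  ... | y , xy≡1 = y , trans (*-comm y x) xy≡1

  x+-1x≡0 : ∀ x → x +ᶠ -1ᶠ *ᶠ x ≡ 0ᶠ
  x+-1x≡0 x = begin
    x +ᶠ -1ᶠ *ᶠ x         ≡⟨ cong (_+ᶠ -1ᶠ *ᶠ x) (*-identityˡ x) ⟨
    1ᶠ *ᶠ x +ᶠ -1ᶠ *ᶠ x   ≡⟨ distribʳ x 1ᶠ -1ᶠ ⟨
    (1ᶠ +ᶠ -1ᶠ) *ᶠ x      ≡⟨ cong (_*ᶠ x) (-‿inverseʳ 1ᶠ) ⟩
    0ᶠ *ᶠ x               ≡⟨ zeroˡ x ⟩
    0ᶠ                    ∎
    where open ≡-Reasoning

  q≥2 : 2 ≤ q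
  q≥2 = Unique-⊆⇒length≤ {xs = 0ᶠ ∷ 1ᶠ ∷ []} ((0≢1 ∷ []) ∷ [] ∷ []) (λ {z} _ → complete z)

  instance
    q-nonZero : NonZero q
    q-nonZero = >-nonZero (≤-trans (s≤s z≤n) q≥2)

  ^-cancelʳ-≤ : ∀ {a b} → q ^ a ≤ q ^ b → a ≤ b
  ^-cancelʳ-≤ qᵃ≤qᵇ = ≮⇒≥ (λ b<a → <⇒≱ (^-monoʳ-< q q≥2 b<a) qᵃ≤qᵇ)

  infixl 6 _⊕_
  infixr 7 _⊙_

  _⊕_ : ∀ {d} → Vec K d → Vec K d → Vec K d
  _⊕_ = zipWith _+ᶠ_

  _⊙_ : ∀ {d} → K → Vec K d → Vec K d
  a ⊙ u = Vec.map (a *ᶠ_) u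

  𝟘 : ∀ d → Vec K d
  𝟘 d = replicate d 0ᶠ

  module _ {d : ℕ} where

    ⊕-assoc : (u v w : Vec K d) → (u ⊕ v) ⊕ w ≡ u ⊕ (v ⊕ w)
    ⊕-assoc = zipWith-assoc +-assoc

    ⊕-comm : (u v : Vec K d) → u ⊕ v ≡ v ⊕ u
    ⊕-comm = zipWith-comm +-comm

    ⊕-identityˡ : (u : Vec K d) → 𝟘 d ⊕ u ≡ u
    ⊕-identityˡ = zipWith-identityˡ +-identityˡ

    ⊕-identityʳ : (u : Vec K d) → u ⊕ 𝟘 d ≡ u
    ⊕-identityʳ = zipWith-identityʳ +-identityʳ

  ⊙-distribˡ-⊕ : ∀ {d} a (u v : Vec K d) → a ⊙ (u ⊕ v) ≡ a ⊙ u ⊕ a ⊙ v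
  ⊙-distribˡ-⊕ a []      []      = refl
  ⊙-distribˡ-⊕ a (x ∷ u) (y ∷ v) = cong₂ _∷_ (distribˡ a x y) (⊙-distribˡ-⊕ a u v)

  ⊙-distribʳ-+ : ∀ {d} a b (u : Vec K d) → (a +ᶠ b) ⊙ u ≡ a ⊙ u ⊕ b ⊙ u
  ⊙-distribʳ-+ a b []      = refl
  ⊙-distribʳ-+ a b (x ∷ u) = cong₂ _∷_ (distribʳ x a b) (⊙-distribʳ-+ a b u)

  ⊙-assoc : ∀ {d} a b (u : Vec K d) → a ⊙ b ⊙ u ≡ (a *ᶠ b) ⊙ u
  ⊙-assoc a b []      = refl
  ⊙-assoc a b (x ∷ u) = cong₂ _∷_ (sym (*-assoc a b x)) (⊙-assoc a b u)

  ⊙-identityˡ : ∀ {d} (u : Vec K d) → 1ᶠ ⊙ u ≡ u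
  ⊙-identityˡ []      = refl
  ⊙-identityˡ (x ∷ u) = cong₂ _∷_ (*-identityˡ x) (⊙-identityˡ u)

  ⊙-zeroˡ : ∀ {d} (u : Vec K d) → 0ᶠ ⊙ u ≡ 𝟘 d
  ⊙-zeroˡ []      = refl
  ⊙-zeroˡ (x ∷ u) = cong₂ _∷_ (zeroˡ x) (⊙-zeroˡ u)

  ⊙-zeroʳ : ∀ {d} a → a ⊙ 𝟘 d ≡ 𝟘 d
  ⊙-zeroʳ {zero}  a = refl
  ⊙-zeroʳ {suc d} a = cong₂ _∷_ (zeroʳ a) (⊙-zeroʳ a)

  ⊕-inverseʳ : ∀ {d} (u : Vec K d) → u ⊕ -1ᶠ ⊙ u ≡ 𝟘 d
  ⊕-inverseʳ []      = refl
  ⊕-inverseʳ (x ∷ u) = cong₂ _∷_ (x+-1x≡0 x) (⊕-inverseʳ u)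

  module _ {d : ℕ} where
    open ≡-Reasoning

    ⊕-interchange : (u v w z : Vec K d) → (u ⊕ v) ⊕ (w ⊕ z) ≡ (u ⊕ w) ⊕ (v ⊕ z)
    ⊕-interchange u v w z = begin
      (u ⊕ v) ⊕ (w ⊕ z)  ≡⟨ ⊕-assoc u v (w ⊕ z) ⟩
      u ⊕ (v ⊕ (w ⊕ z))  ≡⟨ cong (u ⊕_) (⊕-assoc v w z) ⟨
      u ⊕ ((v ⊕ w) ⊕ z)  ≡⟨ cong (λ y → u ⊕ (y ⊕ z)) (⊕-comm v w) ⟩
      u ⊕ ((w ⊕ v) ⊕ z)  ≡⟨ cong (u ⊕_) (⊕-assoc w v z) ⟩
      u ⊕ (w ⊕ (v ⊕ z))  ≡⟨ ⊕-assoc u w (v ⊕ z) ⟨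
      (u ⊕ w) ⊕ (v ⊕ z)  ∎

    ⊕-move : (u v w : Vec K d) → u ⊕ v ≡ w → u ≡ w ⊕ -1ᶠ ⊙ v
    ⊕-move u v w u⊕v≡w = begin
      u                    ≡⟨ ⊕-identityʳ u ⟨
      u ⊕ 𝟘 d              ≡⟨ cong (u ⊕_) (⊕-inverseʳ v) ⟨
      u ⊕ (v ⊕ -1ᶠ ⊙ v)    ≡⟨ ⊕-assoc u v (-1ᶠ ⊙ v) ⟨
      (u ⊕ v) ⊕ -1ᶠ ⊙ v    ≡⟨ cong (_⊕ -1ᶠ ⊙ v) u⊕v≡w ⟩
      w ⊕ -1ᶠ ⊙ v          ∎

    ⊕-cancelʳ : (u v w : Vec K d) → u ⊕ w ≡ v ⊕ w → u ≡ v
    ⊕-cancelʳ u v w u⊕w≡v⊕w = begin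
      u                    ≡⟨ ⊕-move u w (v ⊕ w) u⊕w≡v⊕w ⟩
      (v ⊕ w) ⊕ -1ᶠ ⊙ w    ≡⟨ ⊕-assoc v w (-1ᶠ ⊙ w) ⟩
      v ⊕ (w ⊕ -1ᶠ ⊙ w)    ≡⟨ cong (v ⊕_) (⊕-inverseʳ w) ⟩
      v ⊕ 𝟘 d              ≡⟨ ⊕-identityʳ v ⟩
      v                    ∎

    u-v≡0⇒u≡v : (u v : Vec K d) → u ⊕ -1ᶠ ⊙ v ≡ 𝟘 d → u ≡ v
    u-v≡0⇒u≡v u v u-v≡0 = ⊕-cancelʳ u v (-1ᶠ ⊙ v) (trans u-v≡0 (sym (⊕-inverseʳ v)))

    ⊙-⊕-solve : ∀ {c y} (v t x : Vec K d) → y *ᶠ c ≡ 1ᶠ → c ⊙ v ⊕ t ≡ x → v ≡ y ⊙ (x ⊕ -1ᶠ ⊙ t)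
    ⊙-⊕-solve {c} {y} v t x yc≡1 cv+t≡x = begin
      v                        ≡⟨ ⊙-identityˡ v ⟨
      1ᶠ ⊙ v                   ≡⟨ cong (_⊙ v) yc≡1 ⟨
      (y *ᶠ c) ⊙ v             ≡⟨ ⊙-assoc y c v ⟨
      y ⊙ c ⊙ v                ≡⟨ cong (y ⊙_) (⊕-move (c ⊙ v) t x cv+t≡x) ⟩
      y ⊙ (x ⊕ -1ᶠ ⊙ t)        ∎

  vectors : ∀ d → List (Vec K d)
  vectors zero    = [] ∷ []
  vectors (suc d) = cartesianProductWith _∷_ elements (vectors d)

  vectors-length : ∀ d → length (vectors d) ≡ q ^ d
  vectors-length zero    = refl
  vectors-length (suc d) =
    trans (length-cartesianProductWith _∷_ elements (vectors d)) (cong (q *_) (vectors-length d))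

  ∈-vectors : ∀ {d} (u : Vec K d) → u ∈ vectors d
  ∈-vectors []      = here refl
  ∈-vectors (x ∷ u) = ∈-cartesianProductWith⁺ _∷_ (complete x) (∈-vectors u)

  vectors-unique : ∀ d → Unique (vectors d)
  vectors-unique zero    = [] ∷ []
  vectors-unique (suc d) = Unique.cartesianProductWith⁺ _∷_ ∷-injective distinct (vectors-unique d)

  _≟ᵛ_ : ∀ {d} → DecidableEquality (Vec K d)
  _≟ᵛ_ = ≡-dec _≟ᶠ_

  ∃? : ∀ {d} {P : Vec K d → Set} → Decidable P → Dec (∃ P)
  ∃? P? with any? P? (vectors _)
  ... | yes some = yes (let u , _ , Pu = find some in u , Pu)
  ... | no none  = no (λ (u , Pu) → none (lose (∈-vectors u) Pu))

  ∀? : ∀ {d} {P : Vec K d → Set} → Decidable P → Dec (∀ u → P u)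
  ∀? P? with all? P? (vectors _)
  ... | yes every = yes (λ u → All.lookup every (∈-vectors u))
  ... | no ¬every = no (λ ∀P → ¬every (All.tabulate (λ {u} _ → ∀P u)))

module ProjectivePoints (𝔽 : FiniteField) where
  open VectorAlgebra 𝔽

  -- The vectors whose first nonzero entry is 1ᶠ: one representative of each point of PG(k - 1, q).
  points : ∀ k → List (Vec K k)
  points zero    = []
  points (suc k) = map (1ᶠ ∷_) (vectors k) List.++ map (0ᶠ ∷_) (points k)

  points-length : ∀ k → length (points k) ≡ gauss1 q k
  points-length zero    = refl
  points-length (suc k) = begin
    length (map (1ᶠ ∷_) (vectors k) List.++ map (0ᶠ ∷_) (points k))
      ≡⟨ length-++ (map (1ᶠ ∷_) (vectors k)) ⟩
    length (map (1ᶠ ∷_) (vectors k)) + length (map (0ᶠ ∷_) (points k))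
      ≡⟨ cong₂ _+_ (length-map _ (vectors k)) (length-map _ (points k)) ⟩
    length (vectors k) + length (points k)
      ≡⟨ cong₂ _+_ (vectors-length k) (points-length k) ⟩
    q ^ k + gauss1 q k ∎
    where open ≡-Reasoning

  ∈-points⁻ : ∀ {k} {c : Vec K (suc k)} → c ∈ points (suc k) →
              (∃ λ t → c ≡ 1ᶠ ∷ t) ⊎ (∃ λ t → t ∈ points k × c ≡ 0ᶠ ∷ t)
  ∈-points⁻ {k} c∈ with ∈-++⁻ (map (1ᶠ ∷_) (vectors k)) c∈
  ... | inj₁ c∈₁ = let t , _ , c≡1∷t = ∈-map⁻ _ c∈₁ in inj₁ (t , c≡1∷t)
  ... | inj₂ c∈₀ = let t , t∈ , c≡0∷t = ∈-map⁻ _ c∈₀ in inj₂ (t , t∈ , c≡0∷t)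

  points-unique : ∀ k → Unique (points k)
  points-unique zero    = []
  points-unique (suc k) = Unique.++⁺ (Unique.map⁺ ∷-injectiveʳ (vectors-unique k))
                                     (Unique.map⁺ ∷-injectiveʳ (points-unique k))
                                     (λ (c∈₁ , c∈₀) → leading-1≢0 c∈₁ c∈₀)
    where
    leading-1≢0 : ∀ {c} → c ∈ map (1ᶠ ∷_) (vectors k) → c ∈ map (0ᶠ ∷_) (points k) → ⊥
    leading-1≢0 c∈₁ c∈₀ with ∈-map⁻ _ c∈₁ | ∈-map⁻ _ c∈₀
    ... | _ , _ , refl | _ , _ , 1∷t≡0∷t = 0≢1 (sym (∷-injectiveˡ 1∷t≡0∷t))

  ∈-points⇒1≤k : ∀ {k} {c : Vec K k} → c ∈ points k → 1 ≤ k
  ∈-points⇒1≤k {suc k} _ = s≤s z≤n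

  points-nonzero : ∀ {k} {c : Vec K k} → c ∈ points k → c ≢ 𝟘 k
  points-nonzero {suc k} c∈ c≡0 with ∈-points⁻ c∈
  ... | inj₁ (t , refl)      = 0≢1 (sym (∷-injectiveˡ c≡0))
  ... | inj₂ (t , t∈ , refl) = points-nonzero t∈ (∷-injectiveʳ c≡0)

  normalize : ∀ {k} (c : Vec K k) → c ≢ 𝟘 k →
              ∃ λ ĉ → ∃ λ μ → ĉ ∈ points k × μ ≢ 0ᶠ × c ≡ μ ⊙ ĉ
  normalize [] []≢[] = contradiction refl []≢[]
  normalize (x ∷ c) x∷c≢0 with x ≟ᶠ 0ᶠ
  ... | yes refl =
    let ĉ , μ , ĉ∈ , μ≢0 , c≡μĉ = normalize c (x∷c≢0 ∘ cong (0ᶠ ∷_))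
    in 0ᶠ ∷ ĉ , μ , ∈-++⁺ʳ (map (1ᶠ ∷_) (vectors _)) (∈-map⁺ _ ĉ∈) , μ≢0 ,
       cong₂ _∷_ (sym (zeroʳ μ)) c≡μĉ
  ... | no x≢0 =
    let y , yx≡1 = inverseˡ x≢0
    in 1ᶠ ∷ y ⊙ c , x , ∈-++⁺ˡ (∈-map⁺ _ (∈-vectors (y ⊙ c))) , x≢0 ,
       cong₂ _∷_ (sym (*-identityʳ x)) (sym (begin
         x ⊙ y ⊙ c       ≡⟨ ⊙-assoc x y c ⟩
         (x *ᶠ y) ⊙ c    ≡⟨ cong (_⊙ c) (trans (*-comm x y) yx≡1) ⟩
         1ᶠ ⊙ c          ≡⟨ ⊙-identityˡ c ⟩
         c               ∎))
    where open ≡-Reasoning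

  points-proportional⇒≡ : ∀ {k} {c c′ : Vec K k} μ → c ∈ points k → c′ ∈ points k → c′ ≡ μ ⊙ c → c ≡ c′
  points-proportional⇒≡ {suc k} μ c∈ c′∈ c′≡μc with ∈-points⁻ c∈ | ∈-points⁻ c′∈
  ... | inj₁ (t , refl) | inj₁ (t′ , refl) =
    let μ≡1 = trans (sym (*-identityʳ μ)) (sym (∷-injectiveˡ c′≡μc))
    in cong (1ᶠ ∷_) (sym (trans (∷-injectiveʳ c′≡μc) (trans (cong (_⊙ t) μ≡1) (⊙-identityˡ t))))
  ... | inj₁ (t , refl) | inj₂ (t′ , t′∈ , refl) =
    let μ≡0 = trans (sym (*-identityʳ μ)) (sym (∷-injectiveˡ c′≡μc))
    in contradiction (trans c′≡μc (trans (cong (_⊙ (1ᶠ ∷ t)) μ≡0) (⊙-zeroˡ _))) (points-nonzero c′∈)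
  ... | inj₂ (t , t∈ , refl) | inj₁ (t′ , refl) =
    contradiction (trans (sym (zeroʳ μ)) (sym (∷-injectiveˡ c′≡μc))) 0≢1
  ... | inj₂ (t , t∈ , refl) | inj₂ (t′ , t′∈ , refl) =
    cong (0ᶠ ∷_) (points-proportional⇒≡ μ t∈ t′∈ (∷-injectiveʳ c′≡μc))

module LinearAlgebra (𝔽 : FiniteField) (m : ℕ) where
  open VectorAlgebra 𝔽
  open Geometry 𝔽 m
  open ≡-Reasoning

  lincomb-cong : ∀ {d} {c c′ : Vector K d} {b b′ : Vector V d} → c ≗ c′ → b ≗ b′ → lincomb c b ≡ lincomb c′ b′
  lincomb-cong {zero}  c≗c′ b≗b′ = refl
  lincomb-cong {suc d} c≗c′ b≗b′ =
    cong₂ _⊕_ (cong₂ _⊙_ (c≗c′ zero) (b≗b′ zero)) (lincomb-cong (c≗c′ ∘ suc) (b≗b′ ∘ suc))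

  -- lincomb with the coefficients given as a Vec, which, unlike a function, can be enumerated and compared.
  lc : ∀ {d} → Vec K d → Vector V d → V
  lc c b = lincomb (Vec.lookup c) b

  lincomb≡lc : ∀ {d} (c : Vector K d) (b : Vector V d) → lincomb c b ≡ lc (Vec.tabulate c) b
  lincomb≡lc c b = lincomb-cong (λ i → sym (lookup∘tabulate c i)) (λ _ → refl)

  lc-𝟘 : ∀ {d} (b : Vector V d) → lc (𝟘 d) b ≡ 0v
  lc-𝟘 {zero}  b = refl
  lc-𝟘 {suc d} b = trans (cong₂ _⊕_ (⊙-zeroˡ (b zero)) (lc-𝟘 (tail b))) (⊕-identityˡ 0v)

  lc-⊕ : ∀ {d} (c c′ : Vec K d) (b : Vector V d) → lc (c ⊕ c′) b ≡ lc c b ⊕ lc c′ b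
  lc-⊕ []      []        b = sym (⊕-identityˡ 0v)
  lc-⊕ (x ∷ c) (x′ ∷ c′) b = begin
    (x +ᶠ x′) ⊙ b zero ⊕ lc (c ⊕ c′) (tail b)
      ≡⟨ cong₂ _⊕_ (⊙-distribʳ-+ x x′ (b zero)) (lc-⊕ c c′ (tail b)) ⟩
    (x ⊙ b zero ⊕ x′ ⊙ b zero) ⊕ (lc c (tail b) ⊕ lc c′ (tail b))
      ≡⟨ ⊕-interchange _ _ _ _ ⟩
    (x ⊙ b zero ⊕ lc c (tail b)) ⊕ (x′ ⊙ b zero ⊕ lc c′ (tail b)) ∎

  lc-⊙ : ∀ {d} a (c : Vec K d) (b : Vector V d) → lc (a ⊙ c) b ≡ a ⊙ lc c b
  lc-⊙ a []      b = sym (⊙-zeroʳ a)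
  lc-⊙ a (x ∷ c) b = begin
    (a *ᶠ x) ⊙ b zero ⊕ lc (a ⊙ c) (tail b)  ≡⟨ cong₂ _⊕_ (sym (⊙-assoc a x (b zero))) (lc-⊙ a c (tail b)) ⟩
    a ⊙ x ⊙ b zero ⊕ a ⊙ lc c (tail b)       ≡⟨ ⊙-distribˡ-⊕ a _ _ ⟨
    a ⊙ (x ⊙ b zero ⊕ lc c (tail b))         ∎

  tail-++ : ∀ {k d} (w : Vector V (suc k)) (s : Vector V d) → tail (w ++ s) ≗ tail w ++ s
  tail-++ {k} w s i = [,]-map (splitAt k i)

  lc-++ : ∀ {k d} (a : Vec K k) (c : Vec K d) (w : Vector V k) (s : Vector V d) →
          lc (a Vec.++ c) (w ++ s) ≡ lc a w ⊕ lc c s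
  lc-++ []      c w s = sym (⊕-identityˡ _)
  lc-++ (x ∷ a) c w s = begin
    x ⊙ w zero ⊕ lc (a Vec.++ c) (tail (w ++ s))
      ≡⟨ cong (x ⊙ w zero ⊕_) (lincomb-cong (λ _ → refl) (tail-++ w s)) ⟩
    x ⊙ w zero ⊕ lc (a Vec.++ c) (tail w ++ s)
      ≡⟨ cong (x ⊙ w zero ⊕_) (lc-++ a c (tail w) s) ⟩
    x ⊙ w zero ⊕ (lc a (tail w) ⊕ lc c s)
      ≡⟨ ⊕-assoc _ _ _ ⟨
    (x ⊙ w zero ⊕ lc a (tail w)) ⊕ lc c s ∎

  infix 4 _∈span_

  _∈span_ : ∀ {d} → V → Vector V d → Set
  x ∈span b = ∃ λ c → x ≡ lc c b

  ∈span? : ∀ {d} (b : Vector V d) → Decidable (_∈span b)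
  ∈span? b x = ∃? (λ c → x ≟ᵛ lc c b)

  0∈span : ∀ {d} (b : Vector V d) → 0v ∈span b
  0∈span b = 𝟘 _ , sym (lc-𝟘 b)

  ∈span-⊕ : ∀ {d} {x y} (b : Vector V d) → x ∈span b → y ∈span b → x ⊕ y ∈span b
  ∈span-⊕ b (c , refl) (c′ , refl) = c ⊕ c′ , sym (lc-⊕ c c′ b)

  ∈span-⊙ : ∀ {d} {x} a (b : Vector V d) → x ∈span b → a ⊙ x ∈span b
  ∈span-⊙ a b (c , refl) = a ⊙ c , sym (lc-⊙ a c b)

  lc∈span : ∀ {d r} {b : Vector V d} (e : Vector V r) → (∀ i → b i ∈span e) → ∀ c → lc c b ∈span e
  lc∈span e b⊆e []      = 0∈span e
  lc∈span e b⊆e (x ∷ c) = ∈span-⊕ e (∈span-⊙ x e (b⊆e zero)) (lc∈span e (b⊆e ∘ suc) c)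

  ∈span-trans : ∀ {d r} {x} {b : Vector V d} (e : Vector V r) → (∀ i → b i ∈span e) → x ∈span b → x ∈span e
  ∈span-trans e b⊆e (c , refl) = lc∈span e b⊆e c

  ∈span-∷ : ∀ {d} {x} v (b : Vector V d) → x ∈span b → x ∈span (v ∷ᵛ b)
  ∈span-∷ v b (c , refl) = 0ᶠ ∷ c , sym (trans (cong (_⊕ lc c b) (⊙-zeroˡ v)) (⊕-identityˡ _))

  ∈span-self : ∀ {d} (b : Vector V d) i → b i ∈span b
  ∈span-self b zero    =
    1ᶠ ∷ 𝟘 _ , sym (trans (cong₂ _⊕_ (⊙-identityˡ (b zero)) (lc-𝟘 (tail b))) (⊕-identityʳ _))
  ∈span-self b (suc i) = ∈span-∷ (b zero) (tail b) (∈span-self (tail b) i)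

  ⊕-lc-𝟘 : ∀ {d} x (s : Vector V d) → x ⊕ lc (𝟘 d) s ≡ x
  ⊕-lc-𝟘 x s = trans (cong (x ⊕_) (lc-𝟘 s)) (⊕-identityʳ x)

  lc-𝟘-⊕ : ∀ {k} (w : Vector V k) x → lc (𝟘 k) w ⊕ x ≡ x
  lc-𝟘-⊕ w x = trans (cong (_⊕ x) (lc-𝟘 w)) (⊕-identityˡ x)

  ∈span-++ˡ : ∀ {k d} {x} (w : Vector V k) (s : Vector V d) → x ∈span w → x ∈span (w ++ s)
  ∈span-++ˡ w s (a , refl) = a Vec.++ 𝟘 _ , sym (trans (lc-++ a (𝟘 _) w s) (⊕-lc-𝟘 (lc a w) s))

  ∈span-++ʳ : ∀ {k d} {x} (w : Vector V k) (s : Vector V d) → x ∈span s → x ∈span (w ++ s)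
  ∈span-++ʳ w s (c , refl) = 𝟘 _ Vec.++ c , sym (trans (lc-++ (𝟘 _) c w s) (lc-𝟘-⊕ w (lc c s)))

  ∈span-++⁻ : ∀ {k d} {x} (w : Vector V k) (s : Vector V d) → x ∈span (w ++ s) →
              ∃ λ a → ∃ λ c → x ≡ lc a w ⊕ lc c s
  ∈span-++⁻ {k} w s (ac , refl) with Vec.splitAt k ac
  ... | a , c , refl = a , c , lc-++ a c w s

  ∈span-cancel : ∀ {d} {c} {v t} (e : Vector V d) → c ≢ 0ᶠ → t ∈span e → c ⊙ v ⊕ t ∈span e → v ∈span e
  ∈span-cancel {v = v} {t} e c≢0 t∈e cv+t∈e with inverseˡ c≢0
  ... | y , yc≡1 = subst (_∈span e) (sym (⊙-⊕-solve v t _ yc≡1 refl))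
                         (∈span-⊙ y e (∈span-⊕ e cv+t∈e (∈span-⊙ -1ᶠ e t∈e)))

  ∋-lc : ∀ {d} (T : Subspace) {b : Vector V d} → (∀ i → T ∋ b i) → ∀ c → T ∋ lc c b
  ∋-lc T b⊆T []      = has-0 T
  ∋-lc T b⊆T (x ∷ c) = closed-+ T _ _ (closed-· T x _ (b⊆T zero)) (∋-lc T (b⊆T ∘ suc) c)

  ∈span-exchange : ∀ {d r} {p y} {s : Vector V d} (e : Vector V r) → (∀ i → s i ∈span e) →
                   y ∈span (p ∷ᵛ s) → ¬ y ∈span s → y ∈span e → p ∈span e
  ∈span-exchange {p = p} {s = s} e s⊆e (c₀ ∷ c , refl) y∉s y∈e with c₀ ≟ᶠ 0ᶠ
  ... | yes refl = contradiction (c , trans (cong (_⊕ lc c s) (⊙-zeroˡ p)) (⊕-identityˡ _)) y∉s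
  ... | no c₀≢0  = ∈span-cancel e c₀≢0 (lc∈span e s⊆e c) y∈e

  ∈span⇒∋ : ∀ {d} {x} (T : Subspace) {b : Vector V d} → (∀ i → T ∋ b i) → x ∈span b → T ∋ x
  ∈span⇒∋ T b⊆T (c , refl) = ∋-lc T b⊆T c

  ∋⇒∈span : ∀ {d} {x} (T : Subspace) ((b , _) : HasDim T d) → T ∋ x → x ∈span b
  ∋⇒∈span T (b , _ , _ , spans) x∈T with spans _ x∈T
  ... | c , refl = Vec.tabulate c , lincomb≡lc c b

  Independent : ∀ {d} → Vector V d → Set
  Independent b = ∀ c → lincomb c b ≡ 0v → ∀ i → c i ≡ 0ᶠ

  Independent-resp-≗ : ∀ {d} {b b′ : Vector V d} → b ≗ b′ → Independent b → Independent b′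
  Independent-resp-≗ b≗b′ b-indep c Σcb′≡0 = b-indep c (trans (lincomb-cong (λ _ → refl) b≗b′) Σcb′≡0)

  independent⇒lc-injective : ∀ {d} {b : Vector V d} → Independent b → ∀ c c′ → lc c b ≡ lc c′ b → c ≡ c′
  independent⇒lc-injective {d} {b} b-indep c c′ lc≡lc′ =
    u-v≡0⇒u≡v c c′ (lookup-𝟘 _ (b-indep _ (begin
      lc (c ⊕ -1ᶠ ⊙ c′) b           ≡⟨ lc-⊕ c _ b ⟩
      lc c b ⊕ lc (-1ᶠ ⊙ c′) b      ≡⟨ cong (lc c b ⊕_) (lc-⊙ -1ᶠ c′ b) ⟩
      lc c b ⊕ -1ᶠ ⊙ lc c′ b        ≡⟨ cong (λ y → lc c b ⊕ -1ᶠ ⊙ y) lc≡lc′ ⟨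
      lc c b ⊕ -1ᶠ ⊙ lc c b         ≡⟨ ⊕-inverseʳ _ ⟩
      0v                            ∎)))
    where
    lookup-𝟘 : ∀ {d} (u : Vec K d) → (∀ i → Vec.lookup u i ≡ 0ᶠ) → u ≡ 𝟘 d
    lookup-𝟘 []      _       = refl
    lookup-𝟘 (x ∷ u) u[i]≡0 = cong₂ _∷_ (u[i]≡0 zero) (lookup-𝟘 u (u[i]≡0 ∘ suc))

  independent-∷ : ∀ {d} {v} {b : Vector V d} → Independent b → ¬ v ∈span b → Independent (v ∷ᵛ b)
  independent-∷ {v = v} {b} b-indep v∉b c Σc[v∷b]≡0 = c≡0
    where
    Σtail : V
    Σtail = lincomb (tail c) b
    c₀≡0 : c zero ≡ 0ᶠ
    c₀≡0 = decidable-stable (c zero ≟ᶠ 0ᶠ) λ c₀≢0 →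
      v∉b (∈span-cancel b c₀≢0 (Vec.tabulate (tail c) , lincomb≡lc (tail c) b)
                               (subst (_∈span b) (sym Σc[v∷b]≡0) (0∈span b)))
    c≡0 : ∀ i → c i ≡ 0ᶠ
    c≡0 zero    = c₀≡0
    c≡0 (suc i) = b-indep (tail c) (begin
      Σtail                      ≡⟨ ⊕-identityˡ Σtail ⟨
      0v ⊕ Σtail                 ≡⟨ cong (_⊕ Σtail) (trans (cong (_⊙ v) c₀≡0) (⊙-zeroˡ v)) ⟨
      c zero ⊙ v ⊕ Σtail         ≡⟨ Σc[v∷b]≡0 ⟩
      0v                         ∎) i

  independent⇒head≢0 : ∀ {d} {b : Vector V (suc d)} → Independent b → b zero ≢ 0v
  independent⇒head≢0 {d} {b} b-indep b₀≡0 = 0≢1 (sym (b-indep (Vec.lookup (1ᶠ ∷ 𝟘 d)) (begin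
    1ᶠ ⊙ b zero ⊕ lc (𝟘 d) (tail b)  ≡⟨ cong₂ _⊕_ (trans (⊙-identityˡ _) b₀≡0) (lc-𝟘 (tail b)) ⟩
    0v ⊕ 0v                          ≡⟨ ⊕-identityˡ 0v ⟩
    0v                               ∎) zero))

  spanned : ∀ {d} → Vector V d → List V
  spanned {d} b = map (λ c → lc c b) (vectors d)

  spanned-length : ∀ {d} (b : Vector V d) → length (spanned b) ≡ q ^ d
  spanned-length {d} b = trans (length-map _ (vectors d)) (vectors-length d)

  ∈-spanned : ∀ {d} {x} (b : Vector V d) → x ∈span b → x ∈ spanned b
  ∈-spanned b (c , refl) = ∈-map⁺ _ (∈-vectors c)

  independent⇒q^d≤ : ∀ {d} {b : Vector V d} {xs : List V} → Independent b → (∀ {x} → x ∈span b → x ∈ xs) →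
                     q ^ d ≤ length xs
  independent⇒q^d≤ {d} {b} b-indep span⊆xs = subst (_≤ _) (spanned-length b)
    (Unique-⊆⇒length≤ (Unique.map⁺ (independent⇒lc-injective b-indep _ _) (vectors-unique d))
                      (λ x∈ → let c , _ , x≡ = ∈-map⁻ _ x∈ in span⊆xs (c , x≡)))

  independent-≤ : ∀ {d r} {b : Vector V d} (e : Vector V r) → Independent b → (∀ i → b i ∈span e) → d ≤ r
  independent-≤ e b-indep b⊆e = ^-cancelʳ-≤ (subst (_ ≤_) (spanned-length e)
    (independent⇒q^d≤ b-indep (∈-spanned e ∘ ∈span-trans e b⊆e)))

  independent-≤-dim : ∀ {d} {b : Vector V d} → Independent b → d ≤ m
  independent-≤-dim b-indep = ^-cancelʳ-≤ (subst (_ ≤_) (vectors-length m)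
    (independent⇒q^d≤ b-indep (λ {x} _ → ∈-vectors x)))

  spanning-≥-dim : ∀ {d} (b : Vector V d) → (∀ x → x ∈span b) → m ≤ d
  spanning-≥-dim b spans = ^-cancelʳ-≤ (subst₂ _≤_ (vectors-length m) (spanned-length b)
    (Unique-⊆⇒length≤ (vectors-unique m) (λ {x} _ → ∈-spanned b (spans x))))

  ⟨_⟩ : ∀ {d} → Vector V d → Subspace
  ⟨ b ⟩ = record
    { mem      = λ x → ⌊ ∈span? b x ⌋
    ; has-0    = ⌊⌋≡true⁺ (∈span? b _) (0∈span b)
    ; closed-+ = λ u v u∈ v∈ → ⌊⌋≡true⁺ (∈span? b _)
                   (∈span-⊕ b (⌊⌋≡true⁻ (∈span? b u) u∈) (⌊⌋≡true⁻ (∈span? b v) v∈))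
    ; closed-· = λ a v v∈ → ⌊⌋≡true⁺ (∈span? b _) (∈span-⊙ a b (⌊⌋≡true⁻ (∈span? b v) v∈))
    }

  ∈⟨⟩⁺ : ∀ {d} {x} (b : Vector V d) → x ∈span b → ⟨ b ⟩ ∋ x
  ∈⟨⟩⁺ {x = x} b = ⌊⌋≡true⁺ (∈span? b x)

  ∈⟨⟩⁻ : ∀ {d} {x} (b : Vector V d) → ⟨ b ⟩ ∋ x → x ∈span b
  ∈⟨⟩⁻ {x = x} b = ⌊⌋≡true⁻ (∈span? b x)

  ⟨⟩-hasDim : ∀ {d} (b : Vector V d) → Independent b → HasDim ⟨ b ⟩ d
  ⟨⟩-hasDim b b-indep =
    b , ∈⟨⟩⁺ b ∘ ∈span-self b , b-indep , λ x x∈ → let c , x≡ = ∈⟨⟩⁻ b x∈ in Vec.lookup c , x≡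

  _∋?_ : (T : Subspace) → Decidable (T ∋_)
  T ∋? x = mem T x Bool.≟ true

  Disjoint? : (T U : Subspace) → Dec (Disjoint T U)
  Disjoint? T U = ∀? (λ v → T ∋? v →-dec U ∋? v →-dec v ≟ᵛ 0v)

  ¬Disjoint⇒∃ : ∀ {T U} → ¬ Disjoint T U → ∃ λ x → T ∋ x × U ∋ x × x ≢ 0v
  ¬Disjoint⇒∃ {T} {U} ¬disj = decidable-stable (∃? (λ x → T ∋? x ×-dec U ∋? x ×-dec ¬? (x ≟ᵛ 0v))) λ ∄ →
    ¬disj (λ v v∈T v∈U → decidable-stable (v ≟ᵛ 0v) (λ v≢0 → ∄ (v , v∈T , v∈U , v≢0)))

  Disjoint-sym : ∀ {T U} → Disjoint T U → Disjoint U T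
  Disjoint-sym disj v v∈U v∈T = disj v v∈T v∈U

  ∋-resp-≐ : ∀ {T U x} → T ≐ U → T ∋ x → U ∋ x
  ∋-resp-≐ {x = x} T≐U x∈T = trans (sym (T≐U x)) x∈T

  ≐-sym : ∀ {T U} → T ≐ U → U ≐ T
  ≐-sym T≐U x = sym (T≐U x)

  ≐-trans : ∀ {T U R} → T ≐ U → U ≐ R → T ≐ R
  ≐-trans T≐U U≐R x = trans (T≐U x) (U≐R x)

  ⊆-antisym : ∀ {T U} → T ⊆ U → U ⊆ T → T ≐ U
  ⊆-antisym {T} {U} T⊆U U⊆T x with mem T x in x∈T | mem U x in x∈U
  ... | true  | _     = trans (sym (T⊆U x x∈T)) x∈U
  ... | false | true  = trans (sym x∈T) (U⊆T x x∈U)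
  ... | false | false = refl

  Disjoint-resp-≐ : ∀ {T T′ U U′} → T ≐ T′ → U ≐ U′ → Disjoint T U → Disjoint T′ U′
  Disjoint-resp-≐ {T} {T′} {U} {U′} T≐T′ U≐U′ disj v v∈T′ v∈U′ =
    disj v (∋-resp-≐ {T′} {T} (≐-sym {T} {T′} T≐T′) v∈T′)
           (∋-resp-≐ {U′} {U} (≐-sym {U} {U′} U≐U′) v∈U′)

  ∈span-++-disjoint : ∀ {k d} {x} {T U : Subspace} (α : Vector V k) (s : Vector V d) →
    (∀ i → T ∋ α i) → (∀ i → U ∋ s i) → Disjoint T U → U ∋ x → x ∈span (α ++ s) → x ∈span s
  ∈span-++-disjoint {x = x} {T} {U} α s α⊆T s⊆U disj x∈U x∈⟨α,s⟩ with ∈span-++⁻ α s x∈⟨α,s⟩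
  ... | a , c , x≡a+t = c , (begin
    x              ≡⟨ x≡a+t ⟩
    lc a α ⊕ lc c s  ≡⟨ cong (_⊕ lc c s) a≡0 ⟩
    0v ⊕ lc c s      ≡⟨ ⊕-identityˡ _ ⟩
    lc c s           ∎)
    where
    a≡x-t : lc a α ≡ x ⊕ -1ᶠ ⊙ lc c s
    a≡x-t = ⊕-move _ _ _ (sym x≡a+t)
    a∈U : U ∋ lc a α
    a∈U = subst (U ∋_) (sym a≡x-t) (closed-+ U _ _ x∈U (closed-· U -1ᶠ _ (∋-lc U s⊆U c)))
    a≡0 : lc a α ≡ 0v
    a≡0 = disj _ (∋-lc T α⊆T a) a∈U

  ++-∷ : ∀ {k d} v (w : Vector V k) (s : Vector V d) → (v ∷ᵛ w) ++ s ≗ v ∷ᵛ (w ++ s)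
  ++-∷ v w s zero    = refl
  ++-∷ v w s (suc i) = tail-++ (v ∷ᵛ w) s i

  record Extension {d} (P : V → Set) (s : Vector V d) : Set where
    field
      k           : ℕ
      w           : Vector V k
      independent : Independent (w ++ s)
      w⊆P         : ∀ i → P (w i)
      spans       : ∀ {v} → P v → v ∈span (w ++ s)

  -- Greedily adjoin vectors of P outside the current span; the fuel is exhausted only
  -- after more than m steps, which independence rules out.
  extend : ∀ {d} {P : V → Set} → Decidable P → (s : Vector V d) → Independent s → Extension P s
  extend {d} {P} P? s s-indep = go (suc m) (λ ()) (m≤m+n (suc m) d) s-indep (λ ())
    where
    go : ∀ fuel {k} (w : Vector V k) → suc m ≤ fuel + (k + d) → Independent (w ++ s) → (∀ i → P (w i)) →
         Extension P s
    go fuel w enough w-indep w⊆P with ∃? (λ v → P? v ×-dec ¬? (∈span? (w ++ s) v))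
    ... | no ∄ = record
      { w = w ; independent = w-indep ; w⊆P = w⊆P
      ; spans = λ {v} Pv → decidable-stable (∈span? (w ++ s) v) (λ v∉ → ∄ (v , Pv , v∉)) }
    go zero    w enough w-indep _ | yes _ = contradiction (independent-≤-dim w-indep) (<⇒≱ enough)
    go (suc f) {k} w enough w-indep w⊆P | yes (v , Pv , v∉) =
      go f (v ∷ᵛ w) (subst (suc m ≤_) (sym (+-suc f (k + d))) enough)
         (Independent-resp-≗ (sym ∘ ++-∷ v w s) (independent-∷ w-indep v∉))
         (λ { zero → Pv ; (suc i) → w⊆P i })

  hyperplane-complement : ∀ {d} (T : Subspace) → HasDim T (suc d) → (s : Vector V d) → Independent s →
    (∀ i → T ∋ s i) → ∃ λ p → T ∋ p × ¬ p ∈span s × (∀ {y} → T ∋ y → y ∈span (p ∷ᵛ s))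
  hyperplane-complement {d} T T-dim@(b , b⊆T , b-indep , _) s s-indep s⊆T
    with ∃? (λ p → T ∋? p ×-dec ¬? (∈span? s p))
  ... | no ∄ = contradiction (independent-≤ s b-indep b⊆⟨s⟩) 1+n≰n
    where
    b⊆⟨s⟩ : ∀ i → b i ∈span s
    b⊆⟨s⟩ i = decidable-stable (∈span? s (b i)) (λ bᵢ∉ → ∄ (b i , b⊆T i , bᵢ∉))
  ... | yes (p , p∈T , p∉s) = p , p∈T , p∉s , λ {y} y∈T → decidable-stable (∈span? (p ∷ᵛ s) y) λ y∉ →
    1+n≰n (independent-≤ b (independent-∷ {b = p ∷ᵛ s} (independent-∷ s-indep p∉s) y∉) (y∷p∷s⊆⟨b⟩ y∈T))
    where
    y∷p∷s⊆⟨b⟩ : ∀ {y} → T ∋ y → ∀ i → (y ∷ᵛ p ∷ᵛ s) i ∈span b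
    y∷p∷s⊆⟨b⟩ y∈T zero          = ∋⇒∈span T T-dim y∈T
    y∷p∷s⊆⟨b⟩ y∈T (suc zero)    = ∋⇒∈span T T-dim p∈T
    y∷p∷s⊆⟨b⟩ y∈T (suc (suc i)) = ∋⇒∈span T T-dim (s⊆T i)

  independent-++-unique : ∀ {k d} {w : Vector V k} {s : Vector V d} → Independent (w ++ s) →
    ∀ a a′ c c′ → lc a w ⊕ lc c s ≡ lc a′ w ⊕ lc c′ s → a ≡ a′
  independent-++-unique {w = w} {s} ws-indep a a′ c c′ eq = ++-injectiveˡ a a′
    (independent⇒lc-injective ws-indep _ _ (trans (lc-++ a c w s) (trans eq (sym (lc-++ a′ c′ w s)))))

  ≐⟨∷⟩-exchange : ∀ {d} {T : Subspace} {p v t μ} {s : Vector V d} → T ∋ p → (∀ i → T ∋ s i) →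
    (∀ {y} → T ∋ y → y ∈span (p ∷ᵛ s)) → μ ≢ 0ᶠ → t ∈span s → p ≡ μ ⊙ v ⊕ t → T ≐ ⟨ v ∷ᵛ s ⟩
  ≐⟨∷⟩-exchange {T = T} {p} {v} {t} {μ} {s} p∈T s⊆T T⊆⟨p,s⟩ μ≢0 t∈⟨s⟩ p≡μv+t =
    ⊆-antisym {T} {⟨ v ∷ᵛ s ⟩}
      (λ y y∈T → ∈⟨⟩⁺ (v ∷ᵛ s) (∈span-trans (v ∷ᵛ s) p∷s⊆⟨v,s⟩ (T⊆⟨p,s⟩ y∈T)))
      (λ y y∈⟨v,s⟩ → ∈span⇒∋ T v∷s⊆T (∈⟨⟩⁻ (v ∷ᵛ s) y∈⟨v,s⟩))
    where
    p∷s⊆⟨v,s⟩ : ∀ i → (p ∷ᵛ s) i ∈span (v ∷ᵛ s)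
    p∷s⊆⟨v,s⟩ zero    = subst (_∈span (v ∷ᵛ s)) (sym p≡μv+t)
      (∈span-⊕ (v ∷ᵛ s) (∈span-⊙ μ (v ∷ᵛ s) (∈span-self (v ∷ᵛ s) zero)) (∈span-∷ v s t∈⟨s⟩))
    p∷s⊆⟨v,s⟩ (suc i) = ∈span-self (v ∷ᵛ s) (suc i)
    v∈⟨p,s⟩ : v ∈span (p ∷ᵛ s)
    v∈⟨p,s⟩ = ∈span-cancel (p ∷ᵛ s) μ≢0 (∈span-∷ p s t∈⟨s⟩)
                (subst (_∈span (p ∷ᵛ s)) p≡μv+t (∈span-self (p ∷ᵛ s) zero))
    v∷s⊆T : ∀ i → T ∋ (v ∷ᵛ s) i
    v∷s⊆T zero    = ∈span⇒∋ T {p ∷ᵛ s} (λ { zero → p∈T ; (suc i) → s⊆T i }) v∈⟨p,s⟩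
    v∷s⊆T (suc i) = s⊆T i

module Flags (𝔽 : FiniteField) (n : ℕ) where
  open FlagGraph 𝔽 n
  open LinearAlgebra 𝔽 (suc (n + n)) using (≐-sym; ≐-trans; Disjoint-resp-≐)

  ≐F-refl : ∀ {f} → f ≐F f
  ≐F-refl = (λ _ → refl) , (λ _ → refl)

  ≐F-trans : ∀ {f g h} → f ≐F g → g ≐F h → f ≐F h
  ≐F-trans {f} {g} {h} (A≐ , B≐) (A≐′ , B≐′) =
    ≐-trans {A f} {A g} {A h} A≐ A≐′ , ≐-trans {B f} {B g} {B h} B≐ B≐′

  ∈⇒∈F : ∀ {f 𝓕} → f ∈ 𝓕 → f ∈F 𝓕
  ∈⇒∈F {f} f∈𝓕 = lose f∈𝓕 (≐F-refl {f})

  ∈F-resp-≐F : ∀ {f g 𝓕} → f ≐F g → g ∈F 𝓕 → f ∈F 𝓕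
  ∈F-resp-≐F {f} {g} f≐g = Any.map (λ {h} → ≐F-trans {f} {g} {h} f≐g)

  Opposite-sym : ∀ {f g} → Opposite f g → Opposite g f
  Opposite-sym (disj₁ , disj₂) = disj₂ , disj₁

  Opposite-resp-≐F : ∀ {f f′ g g′} → f ≐F f′ → g ≐F g′ → Opposite f g → Opposite f′ g′
  Opposite-resp-≐F {f} {f′} {g} {g′} (Af≐ , Bf≐) (Ag≐ , Bg≐) (disj₁ , disj₂) =
    Disjoint-resp-≐ {A f} {A f′} {B g} {B g′} Af≐ Bg≐ disj₁ ,
    Disjoint-resp-≐ {A g} {A g′} {B f} {B f′} Ag≐ Bf≐ disj₂

  ∈F-maximal : ∀ {𝓕 g} → IsMaximalCoclique 𝓕 → ¬ Opposite g g → (∀ {h} → h ∈ 𝓕 → ¬ Opposite g h) → g ∈F 𝓕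
  ∈F-maximal {𝓕} {g} (𝓕-coclique , 𝓕-maximal) g≁g g≁𝓕 =
    𝓕-maximal (g ∷ 𝓕) g∷𝓕-coclique (λ _ → there) g (here (≐F-refl {g}))
    where
    g≁ : ∀ {f h} → f ≐F g → h ∈F 𝓕 → ¬ Opposite f h
    g≁ {f} {h} f≐g h∈F𝓕 f⋈h with find h∈F𝓕
    ... | h′ , h′∈𝓕 , h≐h′ = g≁𝓕 h′∈𝓕 (Opposite-resp-≐F {f} {g} {h} {h′} f≐g h≐h′ f⋈h)
    g∷𝓕-coclique : IsCoclique (g ∷ 𝓕)
    g∷𝓕-coclique f h (here f≐g) (here h≐g) f⋈h = g≁g (Opposite-resp-≐F {f} {g} {h} {g} f≐g h≐g f⋈h)
    g∷𝓕-coclique f h (here f≐g) (there h∈) f⋈h = g≁ {f} {h} f≐g h∈ f⋈h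
    g∷𝓕-coclique f h (there f∈) (here h≐g) f⋈h = g≁ {h} {f} h≐g f∈ (Opposite-sym {f} {h} f⋈h)
    g∷𝓕-coclique f h (there f∈) (there h∈) f⋈h = 𝓕-coclique f h f∈ h∈ f⋈h


-- n = n₁ + 1 ≥ 1, so that an (n - 1)-space has vector dimension n (n ∸ 1 would truncate at n = 0).
module MaximalCocliques (𝔽 : FiniteField) (n₁ : ℕ) where
  n : ℕ
  n = suc n₁
  open FlagGraph 𝔽 n
  open VectorAlgebra 𝔽
  open ProjectivePoints 𝔽
  open LinearAlgebra 𝔽 (suc (n + n))
  open Flags 𝔽 n

  module FlagsThrough (𝓕 : List Flag) (𝓕-maximal : IsMaximalCoclique 𝓕) (S : Subspace) (S-dim : HasDim S n) where
    s : Vector V n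
    s = proj₁ S-dim

    s⊆S : ∀ i → S ∋ s i
    s⊆S = proj₁ (proj₂ S-dim)

    s-indep : Independent s
    s-indep = proj₁ (proj₂ (proj₂ S-dim))

    α : Flag → Vector V n
    α h = proj₁ (A-sp h)

    ⟨A,S⟩ : Flag → Vector V (n + n)
    ⟨A,S⟩ h = α h ++ s

    s⊆⟨A,S⟩ : ∀ h i → s i ∈span ⟨A,S⟩ h
    s⊆⟨A,S⟩ h i = ∈span-++ʳ (α h) s (∈span-self s i)

    InW : V → Set
    InW v = All (λ h → Disjoint (B h) S → v ∈span ⟨A,S⟩ h) 𝓕

    InW? : Decidable InW
    InW? v = all? (λ h → Disjoint? (B h) S →-dec ∈span? (⟨A,S⟩ h) v) 𝓕

    InW-lc : ∀ {d} {b : Vector V d} → (∀ i → InW (b i)) → ∀ c → InW (lc c b)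
    InW-lc b⊆W c = All.tabulate λ {h} h∈𝓕 Bh∩S=∅ → lc∈span (⟨A,S⟩ h) (λ i → All.lookup (b⊆W i) h∈𝓕 Bh∩S=∅) c

    -- Opaque, as unification would otherwise unfold the exhaustive search inside extend.
    opaque
      W-basis : Extension InW s
      W-basis = extend InW? s s-indep

    open Extension W-basis public
      renaming (independent to ws-indep; spans to ws-spans; w⊆P to w⊆W)

    S⊆B : ∀ f → A f ≐ S → ∀ i → B f ∋ s i
    S⊆B f Af≐S i = A⊆B f (s i) (∋-resp-≐ {S} {A f} (≐-sym {A f} {S} Af≐S) (s⊆S i))

    B⊆W : ∀ f → f ∈F 𝓕 → A f ≐ S → ∀ {x} → B f ∋ x → InW x
    B⊆W f f∈𝓕 Af≐S {x} x∈B with hyperplane-complement (B f) (B-sp f) s s-indep (S⊆B f Af≐S)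
    ... | p , p∈B , p∉s , B⊆⟨p,s⟩ = All.tabulate λ {h} h∈𝓕 Bh∩S=∅ →
      ∈span-trans {b = p ∷ᵛ s} (⟨A,S⟩ h)
        (λ { zero → p∈⟨A,S⟩ h∈𝓕 Bh∩S=∅ ; (suc i) → s⊆⟨A,S⟩ h i }) (B⊆⟨p,s⟩ x∈B)
      where
      -- f and h are not opposite, and A f = S misses B h, so some y ≠ 0 lies in A h ∩ B f.
      p∈⟨A,S⟩ : ∀ {h} → h ∈ 𝓕 → Disjoint (B h) S → p ∈span ⟨A,S⟩ h
      p∈⟨A,S⟩ {h} h∈𝓕 Bh∩S=∅ with ¬Disjoint⇒∃ {A h} {B f} (λ Ah∩Bf=∅ →
                                      proj₁ 𝓕-maximal f h f∈𝓕 (∈⇒∈F h∈𝓕) (Af∩Bh=∅ , Ah∩Bf=∅))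
        where
        Af∩Bh=∅ : Disjoint (A f) (B h)
        Af∩Bh=∅ v v∈Af v∈Bh = Bh∩S=∅ v v∈Bh (∋-resp-≐ {A f} {S} Af≐S v∈Af)
      ... | y , y∈Ah , y∈Bf , y≢0 =
        ∈span-exchange (⟨A,S⟩ h) (s⊆⟨A,S⟩ h) (B⊆⟨p,s⟩ y∈Bf)
          (λ y∈⟨s⟩ → y≢0 (Bh∩S=∅ y (A⊆B h y y∈Ah) (∈span⇒∋ S s⊆S y∈⟨s⟩)))
          (∈span-++ˡ (α h) s (∋⇒∈span (A h) (A-sp h) y∈Ah))

    lc-w∉⟨s⟩ : ∀ {c} → c ≢ 𝟘 k → ¬ lc c w ∈span s
    lc-w∉⟨s⟩ {c} c≢0 (c′ , lc≡lc′) = c≢0 (independent-++-unique ws-indep c (𝟘 k) (𝟘 n) c′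
      (trans (⊕-lc-𝟘 (lc c w) s) (trans lc≡lc′ (sym (lc-𝟘-⊕ w (lc c′ s))))))

    flag-through : (c : Vec K k) → c ≢ 𝟘 k → Flag
    flag-through c c≢0 = flag S ⟨ lc c w ∷ᵛ s ⟩ S-dim
      (⟨⟩-hasDim (lc c w ∷ᵛ s) (independent-∷ {b = s} s-indep (lc-w∉⟨s⟩ c≢0)))
      (λ x x∈S → ∈⟨⟩⁺ (lc c w ∷ᵛ s) (∈span-∷ (lc c w) s (∋⇒∈span S S-dim x∈S)))

    flag-through-∈F : ∀ c (c≢0 : c ≢ 𝟘 k) → flag-through c c≢0 ∈F 𝓕
    flag-through-∈F c c≢0 = ∈F-maximal {g = flag-through c c≢0} 𝓕-maximal not-self-opposite not-opposite
      where
      v∷s⊆B : ∀ i → ⟨ lc c w ∷ᵛ s ⟩ ∋ (lc c w ∷ᵛ s) i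
      v∷s⊆B = ∈⟨⟩⁺ (lc c w ∷ᵛ s) ∘ ∈span-self (lc c w ∷ᵛ s)
      not-self-opposite : ¬ Opposite (flag-through c c≢0) (flag-through c c≢0)
      not-self-opposite (S∩B=∅ , _) =
        independent⇒head≢0 {b = s} s-indep (S∩B=∅ (s zero) (s⊆S zero) (v∷s⊆B (suc zero)))
      -- lc c w lies in W ⊆ ⟨A h, S⟩, and A h misses B, so lc c w would lie in S.
      not-opposite : ∀ {h} → h ∈ 𝓕 → ¬ Opposite (flag-through c c≢0) h
      not-opposite {h} h∈𝓕 (S∩Bh=∅ , Ah∩B=∅) = lc-w∉⟨s⟩ c≢0
        (∈span-++-disjoint {T = A h} {⟨ lc c w ∷ᵛ s ⟩} (α h) s (proj₁ (proj₂ (A-sp h))) (v∷s⊆B ∘ suc)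
          Ah∩B=∅ (v∷s⊆B zero)
          (All.lookup (InW-lc w⊆W c) h∈𝓕 (Disjoint-sym {S} {B h} S∩Bh=∅)))

    ∈F⇒≐flag-through : ∀ f → f ∈F 𝓕 → A f ≐ S →
      ∃ λ ĉ → Σ (ĉ ∈ points k) λ ĉ∈ → f ≐F flag-through ĉ (points-nonzero ĉ∈)
    ∈F⇒≐flag-through f f∈𝓕 Af≐S with hyperplane-complement (B f) (B-sp f) s s-indep (S⊆B f Af≐S)
    ... | p , p∈B , p∉s , B⊆⟨p,s⟩ with ∈span-++⁻ w s (ws-spans {p} (B⊆W f f∈𝓕 Af≐S p∈B))
    ... | c , t , p≡ with c ≟ᵛ 𝟘 k
    ... | yes refl = contradiction (t , trans p≡ (lc-𝟘-⊕ w (lc t s))) p∉s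
    ... | no c≢0 with normalize c c≢0
    ... | ĉ , μ , ĉ∈ , μ≢0 , c≡μĉ = ĉ , ĉ∈ , Af≐S ,
      ≐⟨∷⟩-exchange {T = B f} {v = lc ĉ w} p∈B (S⊆B f Af≐S) B⊆⟨p,s⟩ μ≢0 (t , refl)
        (trans p≡ (cong (_⊕ lc t s) (trans (cong (λ c → lc c w) c≡μĉ) (lc-⊙ μ ĉ w))))

    flag-through-injective : ∀ {c c′} (c∈ : c ∈ points k) (c′∈ : c′ ∈ points k) →
      flag-through c (points-nonzero c∈) ≐F flag-through c′ (points-nonzero c′∈) → c ≡ c′
    flag-through-injective {c} {c′} c∈ c′∈ (_ , B≐B′)
      with ∈⟨⟩⁻ (lc c w ∷ᵛ s) (∋-resp-≐ {⟨ lc c′ w ∷ᵛ s ⟩} {⟨ lc c w ∷ᵛ s ⟩}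
             (≐-sym {⟨ lc c w ∷ᵛ s ⟩} {⟨ lc c′ w ∷ᵛ s ⟩} B≐B′)
             (∈⟨⟩⁺ (lc c′ w ∷ᵛ s) (∈span-self (lc c′ w ∷ᵛ s) zero)))
    ... | a₀ ∷ a , lc-c′≡ = points-proportional⇒≡ a₀ c∈ c′∈
      (independent-++-unique ws-indep c′ (a₀ ⊙ c) (𝟘 n) a
        (trans (⊕-lc-𝟘 (lc c′ w) s) (trans lc-c′≡ (cong (_⊕ lc a s) (sym (lc-⊙ a₀ c w))))))

    numFlagsWith : NumFlagsWith 𝓕 S (gauss1 q k)
    numFlagsWith = flags , flags-complete , flags-sound , flags-distinct ,
                   trans (length-mapWith∈ (points k) _) (points-length k)
      where
      flags : List Flag
      flags = mapWith∈ (points k) (λ c∈ → flag-through _ (points-nonzero c∈))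
      flags-complete : ∀ f → f ∈F 𝓕 × A f ≐ S → f ∈F flags
      flags-complete f (f∈𝓕 , Af≐S) = mapWith∈⁺ _ (∈F⇒≐flag-through f f∈𝓕 Af≐S)
      flags-sound : ∀ f → f ∈F flags → f ∈F 𝓕 × A f ≐ S
      flags-sound f f∈flags with mapWith∈⁻ (points k) _ f∈flags
      ... | c , c∈ , f≐ =
        ∈F-resp-≐F {f} {flag-through c (points-nonzero c∈)} f≐ (flag-through-∈F c (points-nonzero c∈)) ,
        proj₁ f≐
      flags-distinct : AllPairs (λ f g → ¬ f ≐F g) flags
      flags-distinct = mapWith∈-AllPairs _≐F_ _ (points-unique k) flag-through-injective

    1≤k : (∃[ f ] (f ∈F 𝓕 × A f ≐ S)) → 1 ≤ k
    1≤k (f , f∈𝓕 , Af≐S) = ∈-points⇒1≤k (proj₁ (proj₂ (∈F⇒≐flag-through f f∈𝓕 Af≐S)))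

    k≤1+n : k ≤ suc n
    k≤1+n = +-cancelʳ-≤ n k (suc n) (independent-≤-dim ws-indep)

    k≡1+n⇔ : k ≡ suc n ⇔ (∀ f → f ∈F 𝓕 → ¬ Disjoint (B f) S)
    k≡1+n⇔ = mk⇔ to from
      where
      to : k ≡ suc n → ∀ f → f ∈F 𝓕 → ¬ Disjoint (B f) S
      to k≡1+n f f∈𝓕 Bf∩S=∅ with find f∈𝓕
      ... | h , h∈𝓕 , f≐h = 1+n≰n (subst (λ k → k + n ≤ n + n) k≡1+n
        (independent-≤ (⟨A,S⟩ h) ws-indep
          (++⁺ (_∈span ⟨A,S⟩ h) (λ j → All.lookup (w⊆W j) h∈𝓕 Bh∩S=∅) (s⊆⟨A,S⟩ h))))
        where
        Bh∩S=∅ : Disjoint (B h) S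
        Bh∩S=∅ = Disjoint-resp-≐ {B f} {B h} {S} {S} (proj₂ f≐h) (λ _ → refl) Bf∩S=∅
      from : (∀ f → f ∈F 𝓕 → ¬ Disjoint (B f) S) → k ≡ suc n
      from B∩S≠∅ = ≤-antisym k≤1+n
        (+-cancelʳ-≤ n (suc n) k (spanning-≥-dim (w ++ s) (λ x → ws-spans (everything-InW x))))
        where
        everything-InW : ∀ x → InW x
        everything-InW x = All.tabulate λ {h} h∈𝓕 Bh∩S=∅ → contradiction Bh∩S=∅ (B∩S≠∅ h (∈⇒∈F h∈𝓕))

corollary2 : (𝔽 : FiniteField) (n : ℕ) → 2 ≤ n →
    let open FiniteField 𝔽 using (q) in
    let open FlagGraph 𝔽 n in
    (𝓕 : List Flag) → IsMaximalCoclique 𝓕 →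
    (S : Subspace) → IsSpace (n ∸ 1) S → (∃[ f ] (f ∈F 𝓕 × A f ≐ S)) →
    ∃[ N ] (NumFlagsWith 𝓕 S N
      × (∃[ k ] (1 ≤ k × k ≤ suc n × N ≡ gauss1 q k))
      × (N ≡ gauss1 q (suc n) ⇔ (∀ f → f ∈F 𝓕 → ¬ Disjoint (B f) S)))
corollary2 𝔽 (suc n₁) _ 𝓕 𝓕-maximal S S-dim through-S =
  gauss1 q k , numFlagsWith , (k , 1≤k through-S , k≤1+n , refl) ,
  mk⇔ (Equivalence.to k≡1+n⇔ ∘ gauss1-injective q) (cong (gauss1 q) ∘ Equivalence.from k≡1+n⇔)
  where
  open VectorAlgebra 𝔽 using (q; q-nonZero)
  open MaximalCocliques.FlagsThrough 𝔽 n₁ 𝓕 𝓕-maximal S S-dim
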